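{- Let $\boldsymbol{k}$ be a field and let $\phi=[0;u_1X+v_1,u_2X+v_2,u_3X+v_3,\ldots]\in\overline{\boldsymbol{k}((X^{ -1}))}$ with $u_i\in\boldsymbol{k}\setminus\{0\}$, $v_i\in\boldsymbol{k}$ for all $i\ge1$, and let $\phi=\sum_{i\ge1}c_iX^{ -i}$ be its Laurent series expansion. Let $\mathcal{R}_\phi$, $\mathcal{U}_\phi$, $\mathcal{L}_\phi$ and $\mathcal{M}_\phi$ be as defined in the context. Then: 1. $\mathcal{L}_\phi$ is a lower triangular matrix and $\mathcal{U}_\phi$ is an upper triangular matrix, both with all diagonal entries nonzero (non-singular). 2. For every $n\ge1$, the $n$th column of $\mathcal{U}_\phi$ collects the coefficients of the $\phi$-Zeckendorf representation of $X^{n-1}$: if $X^{n-1}=\sum_{i=0}^{n-1}z_iF_i(X)$, then the $n$th column is $(z_0,z_1,\ldots,z_{n-1},0,0,\ldots)^T$. 3. The product $\mathcal{L}_\phi\mathcal{U}_\phi$ is a Hankel matrix, i.e. its $(i,j)$ entry depends only on $i+j$. 4. $u_1^{ -1}\mathcal{L}_\phi\mathcal{U}_\phi=\mathcal{M}_\phi$.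
   Context: $\boldsymbol{k}((X^{ -1}))$ is the field of formal Laurent series in $X^{ -1}$ over $\boldsymbol{k}$, and $\overline{\boldsymbol{k}((X^{ -1}))}=\{\sum_{i\ge1}c_iX^{ -i}:c_i\in\boldsymbol{k}\}$. The continued fraction $[0;A_1,A_2,\ldots]$ means $\cfrac{1}{A_1+\cfrac{1}{A_2+\cdots}}$. The Fibonacci polynomials associated with $\phi$ are $F_{ -1}=0$, $F_0=1$, $F_n(X)=(u_nX+v_n)F_{n-1}(X)+F_{n-2}(X)$ for $n\ge1$; $\deg F_n=n$, so each polynomial $P$ of degree $r$ has a unique $\phi$-Zeckendorf representation $P=\sum_{i=0}^r z_iF_i(X)$, $z_i\in\boldsymbol{k}$. All matrices are indexed by $\mathbb N\times\mathbb N$ (rows and columns starting at 1). Let $\mathcal{B}_\phi=(b_{i,j})$ with $b_{i,i}=-v_i$, $b_{j+1,j}=1$, $b_{j-1,j}=-1$, and all other entries $0$; let $\mathcal{D}_\phi=\mathrm{diag}(u_1^{ -1},u_2^{ -1},\ldots)$ and $\mathcal{R}_\phi=\mathcal{B}_\phi\mathcal{D}_\phi$ (a tridiagonal matrix). The matrix $\mathcal{U}_\phi$ has columns $\mathbf{u}_1=(1,0,0,\ldots)^T$ and $\mathbf{u}_{n+1}=\mathcal{R}_\phi\mathbf{u}_n$ for $n\ge1$. The matrix $\mathcal{L}_\phi$ has rows $\mathbf{l}_1=(1,0,0,\ldots)$ and $\mathbf{l}_{n+1}=\mathbf{l}_n\mathcal{R}_\phi$ for $n\ge1$. The Hankel matrix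 associated with $\phi$ is $\mathcal{M}_\phi=(m_{i,j})_{i,j\ge1}$ with $m_{i,j}=c_{i+j-1}$. (All matrix products here involve only finite sums.) -}

module Defs where

open import Level using (Level; _⊔_) renaming (suc to lsuc)
open import Data.Nat using (ℕ; zero; suc; _∸_; _≤_; _<_) renaming (_+_ to _+ℕ_)
open import Data.Nat.Properties using (_≟_)
open import Data.Product using (Σ; _×_; _,_)
open import Data.Bool using (if_then_else_)
open import Relation.Nullary using (¬_)
open import Relation.Nullary.Decidable using (⌊_⌋)
open import Algebra.Bundles using (CommutativeRing)

record Field (c ℓ : Level) : Set (lsuc (c ⊔ ℓ)) where
  field
    commutativeRing : CommutativeRing c ℓ
  open CommutativeRing commutativeRing public
  field
    0≉1       : ¬ (0# ≈ 1#)
    inv       : (x : Carrier) → ¬ (x ≈ 0#) → Carrier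
    inv-right : (x : Carrier) (p : ¬ (x ≈ 0#)) → x * inv x p ≈ 1#

-- Conventions (ALL 0-based):
--   u n , v n   stand for u_{n+1}, v_{n+1} of the paper;
--   a polynomial is its coefficient function  p j = coefficient of X^j;
--   a series in X^{-1}k[[X^{-1}]] is  s i = coefficient of X^{-(i+1)};
--   an infinite matrix is  M i j = entry (i+1, j+1) of the paper.
module Phi {c ℓ} (K : Field c ℓ) (u v : ℕ → Field.Carrier K)
           (hu : ∀ n → ¬ (Field._≈_ K (u n) (Field.0# K))) where
  open Field K public

  Poly : Set c
  Poly = ℕ → Carrier

  Ser : Set c
  Ser = ℕ → Carrier

  Mat : Set c
  Mat = ℕ → ℕ → Carrier

  sumTo : ℕ → (ℕ → Carrier) → Carrier
  sumTo zero    f = 0#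
  sumTo (suc N) f = sumTo N f + f N

  -- product term  (s * t) at X^{-(k+1)}, for s, t in X^{-1}k[[X^{-1}]]
  convTerm : Ser → Ser → ℕ → Carrier
  convTerm s t zero    = 0#
  convTerm s t (suc m) = sumTo (suc m) (λ a → s a * t (m ∸ a))

  -- s is the expansion of 1/(aX + b + t) , i.e.  s * ((aX + b) + t) = 1
  -- (coefficient of X^0, then coefficient of X^{-(k+1)} for every k)
  Recip : Carrier → Carrier → Ser → Ser → Set ℓ
  Recip a b t s = (a * s 0 ≈ 1#)
                × (∀ k → (a * s (suc k) + b * s k) + convTerm s t k ≈ 0#)

  -- CFExp m n s : s is the expansion of the finite continued fraction
  --   [0; u_{m+1}X+v_{m+1}, ..., u_{m+n}X+v_{m+n}]   (paper's 1-based indices)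
  CFExp : ℕ → ℕ → Ser → Set (c ⊔ ℓ)
  CFExp m zero    s = Level.Lift c (∀ i → s i ≈ 0#)
  CFExp m (suc n) s = Σ Ser (λ t → CFExp (suc m) n t × Recip (u m) (v m) t s)

  -- cs is the Laurent expansion of phi: the X^{-1}-adic limit of the
  -- (expansions of the) convergents [0; A_1, ..., A_n].
  IsExpansion : Ser → Set (c ⊔ ℓ)
  IsExpansion cs = ∀ N → Σ ℕ (λ n₀ → ∀ n → n₀ ≤ n → ∀ s → CFExp 0 n s
                       → ∀ i → i ≤ N → cs i ≈ s i)

  shiftX : Poly → Poly
  shiftX p zero    = 0#
  shiftX p (suc j) = p j

  linMul : Carrier → Carrier → Poly → Poly
  linMul a b p j = a * shiftX p j + b * p j

  onePoly : Poly
  onePoly zero    = 1#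
  onePoly (suc j) = 0#

  F : ℕ → Poly
  F zero          = onePoly
  F (suc zero)    = linMul (u 0) (v 0) onePoly
  F (suc (suc n)) = λ j → linMul (u (suc n)) (v (suc n)) (F (suc n)) j + F n j

  Xpow : ℕ → Poly
  Xpow n j = if ⌊ j ≟ n ⌋ then 1# else 0#

  B : Mat
  B i j = if ⌊ i ≟ j ⌋ then - v i
          else if ⌊ i ≟ suc j ⌋ then 1#
          else if ⌊ suc i ≟ j ⌋ then - 1#
          else 0#

  R : Mat
  R i j = B i j * inv (u j) (hu j)

  -- (R x)_i ; only j ≤ i+1 can contribute since R is tridiagonal
  R·_ : Ser → Ser
  (R· x) i = sumTo (suc (suc i)) (λ j → R i j * x j)

  -- (x R)_j ; only i ≤ j+1 can contribute since R is tridiagonal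
  _·R : Ser → Ser
  (x ·R) j = sumTo (suc (suc j)) (λ i → x i * R i j)

  e₀ : Ser
  e₀ zero    = 1#
  e₀ (suc i) = 0#

  Ucol : ℕ → Ser
  Ucol zero    = e₀
  Ucol (suc n) = R· (Ucol n)

  Lrow : ℕ → Ser
  Lrow zero    = e₀
  Lrow (suc n) = Lrow n ·R

  U : Mat
  U i j = Ucol j i

  L : Mat
  L i j = Lrow i j

  -- Hankel matrix of phi:  m_{i,j} = c_{i+j-1}  (1-based)
  M : Ser → Mat
  M cs i j = cs (i +ℕ j)

  ProdEntry : Mat → Mat → ℕ → ℕ → Carrier → Set ℓ
  ProdEntry A B' i j x =
    Σ ℕ (λ N → (∀ k → N ≤ k → A i k * B' k j ≈ 0#)
             × (sumTo N (λ k → A i k * B' k j) ≈ x))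

-- R is tridiagonal with nonzero sub- and superdiagonal, so the rows e₀Rⁿ of L and the
-- columns Rⁿe₀ of U are supported on [0, n] with nonzero n-th entry, and
-- (LU)ᵢⱼ = e₀RⁱRʲe₀ = U₀,ᵢ₊ⱼ depends only on i + j.  The three-term recurrence of the
-- Fibonacci polynomials says X F_l = Σᵢ R_il F_i, so multiplying X^n = Σᵢ U_in F_i by X
-- gives the expansion of X^(n+1); the digits are unique because deg F_i = i.
-- Finally, let T_0, T_1, … be the tails of a truncation of φ.  The series
-- (-1)^l T_0 ⋯ T_l (the part of F_l T_0 below X^0) satisfy the same recurrence, X now
-- shifting coefficients, and vanish to order l + 1; so their k-th coefficients are
-- u_1⁻¹ L_kl, and c_(k+1) = u_1⁻¹ L_k0 = u_1⁻¹ U_0k.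

{-# OPTIONS --safe #-}
module Submission where

open import Defs
open import Data.Nat using (ℕ; _≤_; _<_; suc) renaming (_+_ to _+ℕ_)
open import Data.Product using (Σ; _×_)
open import Relation.Nullary using (¬_)

open import Data.Nat using (zero; z≤n; s≤s; _∸_; _<?_; _≤?_)
import Data.Nat.Properties as ℕₚ
open ℕₚ
  using (_≟_; ≤-refl; ≤-trans; ≤-total; ≤-pred; ≤-<-trans; <⇒≤; ≮⇒≥; n≮n; <-cmp;
         m<n⇒m<1+n; m≤n⇒m<n∨m≡n; n≤1+n; m≤m+n; m≤n+m;
         n∸n≡0)
open import Data.Product using (_,_; proj₁; proj₂)
open import Data.Sum using (inj₁; inj₂)
open import Data.Bool using (if_then_else_)
open import Data.Empty using (⊥-elim)
open import Function using (_∘_)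
open import Algebra.Bundles using (CommutativeRing)
open import Level using (lift)
open import Relation.Binary.Definitions using (tri<; tri≈; tri>)
open import Relation.Binary.PropositionalEquality as ≡ using (_≡_; _≢_)
open import Relation.Nullary using (Dec; yes; no)
open import Relation.Nullary.Decidable using (⌊_⌋)

if-yes : ∀ {a p} {A : Set a} {P : Set p} (d : Dec P) {x y : A} → P → (if ⌊ d ⌋ then x else y) ≡ x
if-yes (yes _) _ = ≡.refl
if-yes (no ¬p) p = ⊥-elim (¬p p)

if-no : ∀ {a p} {A : Set a} {P : Set p} (d : Dec P) {x y : A} → ¬ P → (if ⌊ d ⌋ then x else y) ≡ y
if-no (yes p) ¬p = ⊥-elim (¬p p)
if-no (no _)  _  = ≡.refl

module CommutativeRingProperties {c ℓ} (R : CommutativeRing c ℓ) where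
  open CommutativeRing R
  open import Algebra.Properties.Ring ring using (-‿distribʳ-*; -‿+-comm)
  open import Algebra.Properties.Group +-group using (\\-leftDividesʳ; //-rightDividesˡ)
  open import Relation.Binary.Reasoning.Setoid setoid

  x*-y≈-[y*x] : ∀ x y → x * - y ≈ - (y * x)
  x*-y≈-[y*x] x y = trans (sym (-‿distribʳ-* x y)) (-‿cong (*-comm x y))

  x≈y-z⇒y≈x+z : ∀ {x y z} → x ≈ y - z → y ≈ x + z
  x≈y-z⇒y≈x+z {x} {y} {z} x≈y-z = sym (trans (+-congʳ x≈y-z) (//-rightDividesˡ z y))

  -y+[t+y]≈t : ∀ y t → - y + (t + y) ≈ t
  -y+[t+y]≈t y t = trans (+-congˡ (+-comm t y)) (\\-leftDividesʳ y t)

  -x+-y+[[t+y]+x]≈t : ∀ x y t → (- x + - y) + ((t + y) + x) ≈ t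
  -x+-y+[[t+y]+x]≈t x y t = begin
    (- x + - y) + ((t + y) + x) ≈⟨ +-cong (-‿+-comm x y) (+-assoc t y x) ⟩
    - (x + y) + (t + (y + x))   ≈⟨ +-congˡ (+-congˡ (+-comm y x)) ⟩
    - (x + y) + (t + (x + y))   ≈⟨ -y+[t+y]≈t (x + y) t ⟩
    t                           ∎

module FieldProperties {c ℓ} (K : Field c ℓ) where
  open Field K
  open import Relation.Binary.Reasoning.Setoid setoid
  open import Algebra.Properties.Ring ring using (-‿involutive; -0#≈0#)

  1≉0 : ¬ (1# ≈ 0#)
  1≉0 1≈0 = 0≉1 (sym 1≈0)

  inv-left : ∀ x (x≉0 : ¬ (x ≈ 0#)) → inv x x≉0 * x ≈ 1#
  inv-left x x≉0 = trans (*-comm _ x) (inv-right x x≉0)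

  x*y≈0⇒y≈0 : ∀ {x y} → ¬ (x ≈ 0#) → x * y ≈ 0# → y ≈ 0#
  x*y≈0⇒y≈0 {x} {y} x≉0 xy≈0 = begin
    y                   ≈⟨ *-identityˡ y ⟨
    1# * y              ≈⟨ *-congʳ (inv-left x x≉0) ⟨
    (inv x x≉0 * x) * y ≈⟨ *-assoc _ x y ⟩
    inv x x≉0 * (x * y) ≈⟨ *-congˡ xy≈0 ⟩
    inv x x≉0 * 0#      ≈⟨ zeroʳ _ ⟩
    0#                  ∎

  *-nonzero : ∀ {x y} → ¬ (x ≈ 0#) → ¬ (y ≈ 0#) → ¬ (x * y ≈ 0#)
  *-nonzero x≉0 y≉0 = y≉0 ∘ x*y≈0⇒y≈0 x≉0

  inv-nonzero : ∀ x (x≉0 : ¬ (x ≈ 0#)) → ¬ (inv x x≉0 ≈ 0#)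
  inv-nonzero x x≉0 x⁻¹≈0 = 1≉0 (trans (sym (inv-left x x≉0)) (trans (*-congʳ x⁻¹≈0) (zeroˡ x)))

  -‿nonzero : ∀ {x} → ¬ (x ≈ 0#) → ¬ (- x ≈ 0#)
  -‿nonzero {x} x≉0 -x≈0 = x≉0 (trans (sym (-‿involutive x)) (trans (-‿cong -x≈0) -0#≈0#))

  *-inv-cancelʳ : ∀ x (x≉0 : ¬ (x ≈ 0#)) y → (x * y) * inv x x≉0 ≈ y
  *-inv-cancelʳ x x≉0 y = begin
    (x * y) * inv x x≉0 ≈⟨ *-comm _ _ ⟩
    inv x x≉0 * (x * y) ≈⟨ *-assoc _ x y ⟨
    (inv x x≉0 * x) * y ≈⟨ *-congʳ (inv-left x x≉0) ⟩
    1# * y              ≈⟨ *-identityˡ y ⟩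
    y                   ∎

  inverse-unique : ∀ x (x≉0 : ¬ (x ≈ 0#)) {y} → x * y ≈ 1# → y ≈ inv x x≉0
  inverse-unique x x≉0 {y} xy≈1 = begin
    y                   ≈⟨ *-inv-cancelʳ x x≉0 y ⟨
    (x * y) * inv x x≉0 ≈⟨ *-congʳ xy≈1 ⟩
    1# * inv x x≉0      ≈⟨ *-identityˡ _ ⟩
    inv x x≉0           ∎

module Properties {c ℓ} (K : Field c ℓ) (u v : ℕ → Field.Carrier K)
                  (hu : ∀ n → ¬ (Field._≈_ K (u n) (Field.0# K))) where
  open Phi K u v hu hiding (zero)
  open CommutativeRingProperties commutativeRing
  open FieldProperties K
  open import Relation.Binary.Reasoning.Setoid setoid
  open import Algebra.Properties.Ring ring using (-‿distribʳ-*; -0#≈0#; -‿+-comm)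
  open import Algebra.Properties.CommutativeSemigroup +-commutativeSemigroup
    using (interchange; xy∙z≈y∙xz)
  open import Algebra.Properties.CommutativeSemigroup *-commutativeSemigroup
    using (x∙yz≈xz∙y; x∙yz≈y∙xz)
  open import Algebra.Properties.Group +-group using (inverseˡ-unique; x∙y⁻¹≈ε⇒x≈y)

  -- Finite sums

  sumTo-cong : ∀ N {f g : ℕ → Carrier} → (∀ j → j < N → f j ≈ g j) → sumTo N f ≈ sumTo N g
  sumTo-cong zero    f≈g = refl
  sumTo-cong (suc N) f≈g = +-cong (sumTo-cong N (λ j → f≈g j ∘ m<n⇒m<1+n)) (f≈g N ≤-refl)

  sumTo-zero : ∀ N {f : ℕ → Carrier} → (∀ j → j < N → f j ≈ 0#) → sumTo N f ≈ 0#
  sumTo-zero zero    f≈0 = refl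
  sumTo-zero (suc N) f≈0 =
    trans (+-cong (sumTo-zero N (λ j → f≈0 j ∘ m<n⇒m<1+n)) (f≈0 N ≤-refl)) (+-identityʳ 0#)

  sumTo-+ : ∀ N (f g : ℕ → Carrier) → sumTo N (λ j → f j + g j) ≈ sumTo N f + sumTo N g
  sumTo-+ zero    f g = sym (+-identityʳ 0#)
  sumTo-+ (suc N) f g = trans (+-congʳ (sumTo-+ N f g)) (interchange _ _ _ _)

  sumTo-*ˡ : ∀ N x (f : ℕ → Carrier) → sumTo N (λ j → x * f j) ≈ x * sumTo N f
  sumTo-*ˡ zero    x f = sym (zeroʳ x)
  sumTo-*ˡ (suc N) x f = trans (+-congʳ (sumTo-*ˡ N x f)) (sym (distribˡ x _ _))

  sumTo-*ʳ : ∀ N x (f : ℕ → Carrier) → sumTo N (λ j → f j * x) ≈ sumTo N f * x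
  sumTo-*ʳ zero    x f = sym (zeroˡ x)
  sumTo-*ʳ (suc N) x f = trans (+-congʳ (sumTo-*ʳ N x f)) (sym (distribʳ x _ _))

  sumTo-neg : ∀ N (f : ℕ → Carrier) → sumTo N (λ j → - f j) ≈ - sumTo N f
  sumTo-neg zero    f = sym -0#≈0#
  sumTo-neg (suc N) f = trans (+-congʳ (sumTo-neg N f)) (-‿+-comm _ _)

  sumTo-extend : ∀ {N} M {f : ℕ → Carrier} → N ≤ M → (∀ j → N ≤ j → f j ≈ 0#) →
                 sumTo M f ≈ sumTo N f
  sumTo-extend zero    z≤n _ = refl
  sumTo-extend (suc M) N≤1+M f≈0 with m≤n⇒m<n∨m≡n N≤1+M
  ... | inj₁ (s≤s N≤M) = trans (+-cong (sumTo-extend M N≤M f≈0) (f≈0 M N≤M)) (+-identityʳ _)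
  ... | inj₂ ≡.refl    = refl

  sumTo-swap : ∀ N M (f : ℕ → ℕ → Carrier) →
    sumTo N (λ i → sumTo M (λ j → f i j)) ≈ sumTo M (λ j → sumTo N (λ i → f i j))
  sumTo-swap zero    M f = sym (sumTo-zero M (λ _ _ → refl))
  sumTo-swap (suc N) M f = trans (+-congʳ (sumTo-swap N M f)) (sym (sumTo-+ M _ _))

  sumTo-single : ∀ N m {f : ℕ → Carrier} → m < N → (∀ j → j < N → j ≢ m → f j ≈ 0#) →
                 sumTo N f ≈ f m
  sumTo-single (suc N) m m<1+N f≈0 with m≤n⇒m<n∨m≡n (≤-pred m<1+N)
  ... | inj₁ m<N = trans (+-cong (sumTo-single N m m<N (λ j → f≈0 j ∘ m<n⇒m<1+n))
                                 (f≈0 N ≤-refl (λ { ≡.refl → n≮n m m<N })))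
                         (+-identityʳ _)
  ... | inj₂ ≡.refl = trans (+-congʳ (sumTo-zero N (λ j j<N → f≈0 j (m<n⇒m<1+n j<N)
                                                     (λ { ≡.refl → n≮n j j<N }))))
                            (+-identityˡ _)

  dot : ℕ → Ser → Ser → Carrier
  dot N x y = sumTo N (λ k → x k * y k)

  Supported : ℕ → Ser → Set ℓ
  Supported a x = ∀ i → a < i → x i ≈ 0#

  supported-*-vanishes : ∀ {a x} {y : Ser} → Supported a x → (∀ i → i ≤ a → y i ≈ 0#) →
                         ∀ i → x i * y i ≈ 0#
  supported-*-vanishes {a} hx hy i with a <? i
  ... | yes a<i = trans (*-congʳ (hx i a<i)) (zeroˡ _)
  ... | no  a≮i = trans (*-congˡ (hy i (≮⇒≥ a≮i))) (zeroʳ _)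

  dot-extend : ∀ {b} N x {y} → Supported b y → suc b ≤ N → dot N x y ≈ dot (suc b) x y
  dot-extend N x hy b<N = sumTo-extend N b<N (λ k b<k → trans (*-congˡ (hy k b<k)) (zeroʳ _))

  dot-e₀ : ∀ N y → dot (suc N) e₀ y ≈ y 0
  dot-e₀ N y = trans (sumTo-single (suc N) 0 (s≤s z≤n) e₀-off) (*-identityˡ (y 0))
    where
      e₀-off : ∀ k → k < suc N → k ≢ 0 → e₀ k * y k ≈ 0#
      e₀-off zero    _ k≢0 = ⊥-elim (k≢0 ≡.refl)
      e₀-off (suc k) _ _   = zeroˡ (y (suc k))

  -- The tridiagonal matrix R

  u⁻¹ : ℕ → Carrier
  u⁻¹ j = inv (u j) (hu j)

  B-diag : ∀ l → B l l ≡ - v l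
  B-diag l = if-yes (l ≟ l) ≡.refl

  B-sub : ∀ l → B (suc l) l ≡ 1#
  B-sub l = ≡.trans (if-no (suc l ≟ l) (λ ())) (if-yes (suc l ≟ suc l) ≡.refl)

  B-sup : ∀ l → B l (suc l) ≡ - 1#
  B-sup l = ≡.trans (if-no (l ≟ suc l) (λ ()))
            (≡.trans (if-no (l ≟ suc (suc l)) (λ ())) (if-yes (suc l ≟ suc l) ≡.refl))

  B-off : ∀ i j → i ≢ j → i ≢ suc j → suc i ≢ j → B i j ≡ 0#
  B-off i j i≢j i≢1+j 1+i≢j =
    ≡.trans (if-no (i ≟ j) i≢j) (≡.trans (if-no (i ≟ suc j) i≢1+j) (if-no (suc i ≟ j) 1+i≢j))

  B-above : ∀ i j → suc (suc i) ≤ j → B i j ≡ 0#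
  B-above i j i+2≤j = B-off i j (λ { ≡.refl → n≮n i (<⇒≤ i+2≤j) })
                                (λ { ≡.refl → n≮n j (<⇒≤ (<⇒≤ i+2≤j)) })
                                (λ { ≡.refl → n≮n (suc i) i+2≤j })

  B-below : ∀ i j → suc (suc j) ≤ i → B i j ≡ 0#
  B-below i j j+2≤i = B-off i j (λ { ≡.refl → n≮n i (<⇒≤ j+2≤i) })
                                (λ { ≡.refl → n≮n (suc j) j+2≤i })
                                (λ { ≡.refl → n≮n i (<⇒≤ (<⇒≤ j+2≤i)) })

  *-B-diag : ∀ x l → x * B l l ≈ - (v l * x)
  *-B-diag x l = trans (*-congˡ (reflexive (B-diag l))) (x*-y≈-[y*x] x (v l))

  *-B-sub : ∀ x l → x * B (suc l) l ≈ x
  *-B-sub x l = trans (*-congˡ (reflexive (B-sub l))) (*-identityʳ x)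

  *-B-sup : ∀ x l → x * B l (suc l) ≈ - x
  *-B-sup x l = trans (*-congˡ (reflexive (B-sup l))) (trans (x*-y≈-[y*x] x 1#) (-‿cong (*-identityˡ x)))

  R-above : ∀ i j → suc (suc i) ≤ j → R i j ≈ 0#
  R-above i j i+2≤j = trans (*-congʳ (reflexive (B-above i j i+2≤j))) (zeroˡ _)

  R-below : ∀ i j → suc (suc j) ≤ i → R i j ≈ 0#
  R-below i j j+2≤i = trans (*-congʳ (reflexive (B-below i j j+2≤i))) (zeroˡ _)

  R-sub-nonzero : ∀ l → ¬ (R (suc l) l ≈ 0#)
  R-sub-nonzero l R≈0 =
    *-nonzero 1≉0 (inv-nonzero _ (hu l)) (trans (*-congʳ (reflexive (≡.sym (B-sub l)))) R≈0)

  R-sup-nonzero : ∀ l → ¬ (R l (suc l) ≈ 0#)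
  R-sup-nonzero l R≈0 = *-nonzero (-‿nonzero 1≉0) (inv-nonzero _ (hu (suc l)))
                                  (trans (*-congʳ (reflexive (≡.sym (B-sup l)))) R≈0)

  -- g (l+1) = (u_l X + v_l) g_l + g_(l-1), read at one coefficient, where t is the
  -- corresponding coefficient of X g_l.
  FibStep : (ℕ → Carrier) → ℕ → Carrier → Set ℓ
  FibStep g zero    t = g 1 ≈ u 0 * t + v 0 * g 0
  FibStep g (suc l) t = g (suc (suc l)) ≈ (u (suc l) * t + v (suc l) * g (suc l)) + g l

  FibStep⇒B-column : ∀ g l t → FibStep g l t → sumTo (suc (suc l)) (λ i → g i * B i l) ≈ u l * t
  FibStep⇒B-column g zero t step = begin
    (0# + g 0 * B 0 0) + g 1 * B 1 0
      ≈⟨ +-cong (trans (+-identityˡ _) (*-B-diag (g 0) 0)) (trans (*-B-sub (g 1) 0) step) ⟩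
    - (v 0 * g 0) + (u 0 * t + v 0 * g 0)
      ≈⟨ -y+[t+y]≈t _ _ ⟩
    u 0 * t ∎
  FibStep⇒B-column g (suc l) t step = begin
    ((sumTo l (λ i → g i * B i (suc l)) + g l * B l (suc l)) + g (suc l) * B (suc l) (suc l))
      + g (suc (suc l)) * B (suc (suc l)) (suc l)
      ≈⟨ +-cong (+-cong (+-cong above (*-B-sup (g l) l)) (*-B-diag (g (suc l)) (suc l)))
                (trans (*-B-sub (g (suc (suc l))) (suc l)) step) ⟩
    ((0# + - g l) + - (v (suc l) * g (suc l))) + ((u (suc l) * t + v (suc l) * g (suc l)) + g l)
      ≈⟨ +-congʳ (+-congʳ (+-identityˡ _)) ⟩
    (- g l + - (v (suc l) * g (suc l))) + ((u (suc l) * t + v (suc l) * g (suc l)) + g l)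
      ≈⟨ -x+-y+[[t+y]+x]≈t _ _ _ ⟩
    u (suc l) * t ∎
    where
      above : sumTo l (λ i → g i * B i (suc l)) ≈ 0#
      above = sumTo-zero l (λ i i<l →
                trans (*-congˡ (reflexive (B-above i (suc l) (s≤s i<l)))) (zeroʳ _))

  FibStep⇒·R : ∀ g l t → FibStep g l t → (g ·R) l ≈ t
  FibStep⇒·R g l t step = begin
    (g ·R) l
      ≈⟨ sumTo-cong (suc (suc l)) (λ i _ → *-assoc (g i) (B i l) (u⁻¹ l)) ⟨
    sumTo (suc (suc l)) (λ i → (g i * B i l) * u⁻¹ l)
      ≈⟨ sumTo-*ʳ (suc (suc l)) (u⁻¹ l) _ ⟩
    sumTo (suc (suc l)) (λ i → g i * B i l) * u⁻¹ l
      ≈⟨ *-congʳ (FibStep⇒B-column g l t step) ⟩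
    (u l * t) * u⁻¹ l
      ≈⟨ *-inv-cancelʳ (u l) (hu l) t ⟩
    t ∎

  -- Triangularity of L and U, and the Hankel property of L U

  ·R-supported : ∀ {a x} → Supported a x → Supported (suc a) (x ·R)
  ·R-supported {a} hx j a+1<j = sumTo-zero (suc (suc j)) (λ i _ →
    supported-*-vanishes hx (λ i i≤a → R-above i j (≤-trans (s≤s (s≤s i≤a)) a+1<j)) i)

  R·-supported : ∀ {b y} → Supported b y → Supported (suc b) (R· y)
  R·-supported {b} hy i b+1<i = sumTo-zero (suc (suc i)) (λ j _ → trans (*-comm _ _)
    (supported-*-vanishes hy (λ j j≤b → R-below i j (≤-trans (s≤s (s≤s j≤b)) b+1<i)) j))

  ·R-top : ∀ {a x} → Supported a x → (x ·R) (suc a) ≈ x a * R a (suc a)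
  ·R-top {a} {x} hx = sumTo-single (suc (suc (suc a))) a (≤-trans (n≤1+n _) (n≤1+n _)) off
    where
      off : ∀ i → i < suc (suc (suc a)) → i ≢ a → x i * R i (suc a) ≈ 0#
      off i _ i≢a with <-cmp i a
      ... | tri< i<a _ _ = trans (*-congˡ (R-above i (suc a) (s≤s i<a))) (zeroʳ _)
      ... | tri≈ _ i≡a _ = ⊥-elim (i≢a i≡a)
      ... | tri> _ _ a<i = trans (*-congʳ (hx i a<i)) (zeroˡ _)

  R·-top : ∀ {b y} → Supported b y → (R· y) (suc b) ≈ R (suc b) b * y b
  R·-top {b} {y} hy = sumTo-single (suc (suc (suc b))) b (≤-trans (n≤1+n _) (n≤1+n _)) off
    where
      off : ∀ j → j < suc (suc (suc b)) → j ≢ b → R (suc b) j * y j ≈ 0#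
      off j _ j≢b with <-cmp j b
      ... | tri< j<b _ _ = trans (*-congʳ (R-below (suc b) j (s≤s j<b))) (zeroˡ _)
      ... | tri≈ _ j≡b _ = ⊥-elim (j≢b j≡b)
      ... | tri> _ _ b<j = trans (*-congˡ (hy j b<j)) (zeroʳ _)

  Lrow-supported : ∀ n → Supported n (Lrow n)
  Lrow-supported zero    (suc i) _ = refl
  Lrow-supported (suc n) = ·R-supported (Lrow-supported n)

  Ucol-supported : ∀ n → Supported n (Ucol n)
  Ucol-supported zero    (suc i) _ = refl
  Ucol-supported (suc n) = R·-supported (Ucol-supported n)

  Lrow-diagonal-nonzero : ∀ n → ¬ (Lrow n n ≈ 0#)
  Lrow-diagonal-nonzero zero    = 1≉0
  Lrow-diagonal-nonzero (suc n) L≈0 = *-nonzero (Lrow-diagonal-nonzero n) (R-sup-nonzero n)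
                                                (trans (sym (·R-top (Lrow-supported n))) L≈0)

  Ucol-diagonal-nonzero : ∀ n → ¬ (Ucol n n ≈ 0#)
  Ucol-diagonal-nonzero zero    = 1≉0
  Ucol-diagonal-nonzero (suc n) U≈0 = *-nonzero (R-sub-nonzero n) (Ucol-diagonal-nonzero n)
                                                (trans (sym (R·-top (Ucol-supported n))) U≈0)

  ·R-adjoint : ∀ {b} N x y → Supported b y → suc (suc b) ≤ N → dot N (x ·R) y ≈ dot N x (R· y)
  ·R-adjoint {b} N x y hy b+2≤N = begin
    sumTo N (λ k → (x ·R) k * y k)
      ≈⟨ sumTo-cong N (λ k _ → column k) ⟩
    sumTo N (λ k → sumTo N (λ l → x l * R l k) * y k)
      ≈⟨ sumTo-cong N (λ k _ → sumTo-*ʳ N (y k) _) ⟨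
    sumTo N (λ k → sumTo N (λ l → (x l * R l k) * y k))
      ≈⟨ sumTo-swap N N _ ⟩
    sumTo N (λ l → sumTo N (λ k → (x l * R l k) * y k))
      ≈⟨ sumTo-cong N (λ l _ → trans (sumTo-cong N (λ k _ → *-assoc _ _ _)) (sumTo-*ˡ N (x l) _)) ⟩
    sumTo N (λ l → x l * sumTo N (λ k → R l k * y k))
      ≈⟨ sumTo-cong N (λ l _ → *-congˡ (row l)) ⟩
    sumTo N (λ l → x l * (R· y) l) ∎
    where
      column : ∀ k → (x ·R) k * y k ≈ sumTo N (λ l → x l * R l k) * y k
      column k with b <? k
      ... | yes b<k = trans (*-congˡ (hy k b<k)) (trans (zeroʳ _) (sym (trans (*-congˡ (hy k b<k)) (zeroʳ _))))
      ... | no  b≮k = *-congʳ (sym (sumTo-extend N (≤-trans (s≤s (s≤s (≮⇒≥ b≮k))) b+2≤N)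
                                  (λ l k+2≤l → trans (*-congˡ (R-below l k k+2≤l)) (zeroʳ _))))
      row : ∀ l → sumTo N (λ k → R l k * y k) ≈ (R· y) l
      row l with ≤-total N (suc (suc l))
      ... | inj₁ N≤l+2 = sym (sumTo-extend (suc (suc l)) N≤l+2 (λ k N≤k →
                           trans (*-congˡ (hy k (≤-trans (n≤1+n _) (≤-trans b+2≤N N≤k)))) (zeroʳ _)))
      ... | inj₂ l+2≤N = sumTo-extend N l+2≤N (λ k l+2≤k → trans (*-congʳ (R-above l k l+2≤k)) (zeroˡ _))

  LU-entry : ∀ i j → dot (suc j) (Lrow i) (Ucol j) ≈ Ucol (i +ℕ j) 0
  LU-entry zero    j = dot-e₀ j (Ucol j)
  LU-entry (suc i) j = begin
    dot (suc j) (Lrow i ·R) (Ucol j)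
      ≈⟨ dot-extend (suc (suc j)) (Lrow i ·R) (Ucol-supported j) (n≤1+n _) ⟨
    dot (suc (suc j)) (Lrow i ·R) (Ucol j)
      ≈⟨ ·R-adjoint (suc (suc j)) (Lrow i) (Ucol j) (Ucol-supported j) ≤-refl ⟩
    dot (suc (suc j)) (Lrow i) (Ucol (suc j))
      ≈⟨ LU-entry i (suc j) ⟩
    Ucol (i +ℕ suc j) 0
      ≡⟨ ≡.cong (λ m → Ucol m 0) (ℕₚ.+-suc i j) ⟩
    Ucol (suc i +ℕ j) 0 ∎

  LU-productEntry : ∀ i j → ProdEntry L U i j (Ucol (i +ℕ j) 0)
  LU-productEntry i j =
    suc j , (λ k j<k → trans (*-congˡ (Ucol-supported j k j<k)) (zeroʳ _)) , LU-entry i j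

  Lrow≈Ucol-at-0 : ∀ m → Lrow m 0 ≈ Ucol m 0
  Lrow≈Ucol-at-0 m = begin
    Lrow m 0                    ≈⟨ *-identityʳ _ ⟨
    Lrow m 0 * 1#               ≈⟨ +-identityˡ _ ⟨
    dot 1 (Lrow m) (Ucol 0)     ≈⟨ LU-entry m 0 ⟩
    Ucol (m +ℕ 0) 0             ≡⟨ ≡.cong (λ k → Ucol k 0) (ℕₚ.+-identityʳ m) ⟩
    Ucol m 0                    ∎

  -- Fibonacci polynomials and Zeckendorf digits

  shiftX-supported : ∀ {a p} → Supported a p → Supported (suc a) (shiftX p)
  shiftX-supported hp (suc j) (s≤s a<j) = hp j a<j

  linMul-supported : ∀ {a p} α β → Supported a p → Supported (suc a) (linMul α β p)
  linMul-supported α β hp j a+1<j =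
    trans (+-cong (trans (*-congˡ (shiftX-supported hp j a+1<j)) (zeroʳ α))
                  (trans (*-congˡ (hp j (<⇒≤ a+1<j))) (zeroʳ β)))
          (+-identityʳ 0#)

  linMul-top : ∀ {a p} α β → Supported a p → linMul α β p (suc a) ≈ α * p a
  linMul-top {a} α β hp = trans (+-congˡ (trans (*-congˡ (hp (suc a) ≤-refl)) (zeroʳ β))) (+-identityʳ _)

  F-supported : ∀ n → Supported n (F n)
  F-supported zero          (suc j) _ = refl
  F-supported (suc zero)    = linMul-supported (u 0) (v 0) (F-supported 0)
  F-supported (suc (suc n)) j n+2<j =
    trans (+-cong (linMul-supported (u (suc n)) (v (suc n)) (F-supported (suc n)) j n+2<j)
                  (F-supported n j (<⇒≤ (<⇒≤ n+2<j))))
          (+-identityʳ 0#)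

  F-leading : ∀ n → F (suc n) (suc n) ≈ u n * F n n
  F-leading zero    = linMul-top (u 0) (v 0) (F-supported 0)
  F-leading (suc n) = trans (+-congˡ (F-supported n (suc (suc n)) (m<n⇒m<1+n ≤-refl)))
                            (trans (+-identityʳ _) (linMul-top (u (suc n)) (v (suc n)) (F-supported (suc n))))

  F-leading-nonzero : ∀ n → ¬ (F n n ≈ 0#)
  F-leading-nonzero zero    = 1≉0
  F-leading-nonzero (suc n) F≈0 = *-nonzero (hu n) (F-leading-nonzero n) (trans (sym (F-leading n)) F≈0)

  F-FibStep : ∀ j l → FibStep (λ i → F i j) l (shiftX (F l) j)
  F-FibStep j zero    = refl
  F-FibStep j (suc l) = refl

  Xpow-zero : ∀ j → Xpow 0 j ≈ F 0 j
  Xpow-zero zero    = refl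
  Xpow-zero (suc j) = refl

  Xpow-suc : ∀ n j → Xpow (suc n) j ≈ shiftX (Xpow n) j
  Xpow-suc n zero    = refl
  Xpow-suc n (suc j) with j ≟ n
  ... | yes ≡.refl = reflexive (if-yes (suc j ≟ suc j) ≡.refl)
  ... | no  j≢n    = reflexive (if-no (suc j ≟ suc n) (j≢n ∘ ℕₚ.suc-injective))

  Xpow-expansion : ∀ n j → Xpow n j ≈ dot (suc n) (λ i → F i j) (Ucol n)
  Xpow-expansion zero    j = trans (Xpow-zero j) (sym (trans (+-identityˡ _) (*-identityʳ _)))
  Xpow-expansion (suc n) j = begin
    Xpow (suc n) j
      ≈⟨ Xpow-suc n j ⟩
    shiftX (Xpow n) j
      ≈⟨ shifted j ⟩
    dot (suc n) (λ l → shiftX (F l) j) (Ucol n)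
      ≈⟨ dot-extend (suc (suc n)) _ (Ucol-supported n) (n≤1+n _) ⟨
    dot (suc (suc n)) (λ l → shiftX (F l) j) (Ucol n)
      ≈⟨ sumTo-cong (suc (suc n)) (λ l _ → *-congʳ (FibStep⇒·R _ l _ (F-FibStep j l))) ⟨
    dot (suc (suc n)) ((λ i → F i j) ·R) (Ucol n)
      ≈⟨ ·R-adjoint (suc (suc n)) _ (Ucol n) (Ucol-supported n) ≤-refl ⟩
    dot (suc (suc n)) (λ i → F i j) (Ucol (suc n)) ∎
    where
      shifted : ∀ j → shiftX (Xpow n) j ≈ dot (suc n) (λ l → shiftX (F l) j) (Ucol n)
      shifted zero    = sym (sumTo-zero (suc n) (λ l _ → zeroˡ _))
      shifted (suc j) = Xpow-expansion n j

  zeckendorf-leading : ∀ n d → (∀ j → dot (suc n) (λ i → F i j) d ≈ 0#) → d n ≈ 0#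
  zeckendorf-leading n d h = x*y≈0⇒y≈0 (F-leading-nonzero n) (begin
    F n n * d n                 ≈⟨ +-identityˡ _ ⟨
    0# + F n n * d n            ≈⟨ +-congʳ lower ⟨
    dot (suc n) (λ i → F i n) d ≈⟨ h n ⟩
    0#                          ∎)
    where
      lower : sumTo n (λ i → F i n * d i) ≈ 0#
      lower = sumTo-zero n (λ i i<n → trans (*-congʳ (F-supported i n i<n)) (zeroˡ _))

  zeckendorf-unique : ∀ n d → (∀ j → dot (suc n) (λ i → F i j) d ≈ 0#) → ∀ i → i ≤ n → d i ≈ 0#
  zeckendorf-unique n d h i i≤n with m≤n⇒m<n∨m≡n i≤n
  ... | inj₂ ≡.refl = zeckendorf-leading n d h
  zeckendorf-unique (suc n) d h i _ | inj₁ (s≤s i≤n) = zeckendorf-unique n d h′ i i≤n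
    where
      h′ : ∀ j → dot (suc n) (λ i → F i j) d ≈ 0#
      h′ j = trans (sym (+-identityʳ _))
                   (trans (+-congˡ (sym (trans (*-congˡ (zeckendorf-leading (suc n) d h)) (zeroʳ _))))
                          (h j))

  Ucol-zeckendorf : ∀ n (z : ℕ → Carrier) → (∀ j → Xpow n j ≈ sumTo (suc n) (λ i → z i * F i j)) →
                    ∀ i → i ≤ n → Ucol n i ≈ z i
  Ucol-zeckendorf n z hz i i≤n =
    x∙y⁻¹≈ε⇒x≈y _ _ (zeckendorf-unique n (λ i → Ucol n i - z i) difference i i≤n)
    where
      difference : ∀ j → dot (suc n) (λ i → F i j) (λ i → Ucol n i - z i) ≈ 0#
      difference j = begin
        dot (suc n) (λ i → F i j) (λ i → Ucol n i - z i)
          ≈⟨ sumTo-cong (suc n) (λ i _ → trans (distribˡ _ _ _) (+-congˡ (x*-y≈-[y*x] _ _))) ⟩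
        sumTo (suc n) (λ i → F i j * Ucol n i + - (z i * F i j))
          ≈⟨ sumTo-+ (suc n) _ _ ⟩
        dot (suc n) (λ i → F i j) (Ucol n) + sumTo (suc n) (λ i → - (z i * F i j))
          ≈⟨ +-cong (sym (Xpow-expansion n j)) (trans (sumTo-neg (suc n) _) (-‿cong (sym (hz j)))) ⟩
        Xpow n j - Xpow n j
          ≈⟨ -‿inverseʳ _ ⟩
        0# ∎

  -- Series in X⁻¹ and the continued fraction φ

  -- the part of (aX + b) x in X⁻¹k[[X⁻¹]]
  linMulSer : Carrier → Carrier → Ser → Ser
  linMulSer a b x k = a * x (suc k) + b * x k

  linMulSer-neg : ∀ a b x k → linMulSer a b (λ i → - x i) k ≈ - linMulSer a b x k
  linMulSer-neg a b x k =
    trans (+-cong (sym (-‿distribʳ-* a _)) (sym (-‿distribʳ-* b _))) (-‿+-comm _ _)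

  convTerm-congʳ : ∀ x {y z : Ser} → (∀ i → y i ≈ z i) → ∀ k → convTerm x y k ≈ convTerm x z k
  convTerm-congʳ x y≈z zero    = refl
  convTerm-congʳ x y≈z (suc k) = sumTo-cong (suc k) (λ a _ → *-congˡ (y≈z (k ∸ a)))

  convTerm-negʳ : ∀ x y k → convTerm x (λ i → - y i) k ≈ - convTerm x y k
  convTerm-negʳ x y zero    = sym -0#≈0#
  convTerm-negʳ x y (suc k) =
    trans (sumTo-cong (suc k) (λ a _ → sym (-‿distribʳ-* _ _))) (sumTo-neg (suc k) _)

  convTerm-+ʳ : ∀ x y z k → convTerm x (λ i → y i + z i) k ≈ convTerm x y k + convTerm x z k
  convTerm-+ʳ x y z zero    = sym (+-identityʳ 0#)
  convTerm-+ʳ x y z (suc k) =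
    trans (sumTo-cong (suc k) (λ a _ → distribˡ _ _ _)) (sumTo-+ (suc k) _ _)

  convTerm-*ʳ : ∀ x a y k → convTerm x (λ i → a * y i) k ≈ a * convTerm x y k
  convTerm-*ʳ x a y zero    = sym (zeroʳ a)
  convTerm-*ʳ x a y (suc k) =
    trans (sumTo-cong (suc k) (λ j _ → x∙yz≈y∙xz (x j) a _)) (sumTo-*ˡ (suc k) a _)

  convTerm-shiftʳ : ∀ x y k → convTerm x y (suc (suc k)) ≈ convTerm x (y ∘ suc) (suc k) + x (suc k) * y 0
  convTerm-shiftʳ x y k =
    +-cong (sumTo-cong (suc k) (λ a a≤k →
             *-congˡ (reflexive (≡.cong y (ℕₚ.+-∸-assoc 1 (≤-pred a≤k))))))
           (*-congˡ (reflexive (≡.cong y (n∸n≡0 k))))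

  -- The first term is the polynomial part a y₀ of (aX + b) y, times x.
  linMulSer-convTerm : ∀ a b x y k →
    linMulSer a b (convTerm x y) k ≈ (a * y 0) * x k + convTerm x (linMulSer a b y) k
  linMulSer-convTerm a b x y zero = begin
    a * (0# + x 0 * y 0) + b * 0#     ≈⟨ +-cong (*-congˡ (+-identityˡ _)) (zeroʳ b) ⟩
    a * (x 0 * y 0) + 0#              ≈⟨ +-congʳ (x∙yz≈xz∙y a (x 0) (y 0)) ⟩
    (a * y 0) * x 0 + 0#              ∎
  linMulSer-convTerm a b x y (suc k) = begin
    a * convTerm x y (suc (suc k)) + b * convTerm x y (suc k)
      ≈⟨ +-congʳ (trans (*-congˡ (convTerm-shiftʳ x y k)) (distribˡ a _ _)) ⟩
    (a * convTerm x (y ∘ suc) (suc k) + a * (x (suc k) * y 0)) + b * convTerm x y (suc k)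
      ≈⟨ xy∙z≈y∙xz _ _ _ ⟩
    a * (x (suc k) * y 0) + (a * convTerm x (y ∘ suc) (suc k) + b * convTerm x y (suc k))
      ≈⟨ +-cong (sym (x∙yz≈xz∙y a (x (suc k)) (y 0))) (+-cong (convTerm-*ʳ x a (y ∘ suc) (suc k)) (convTerm-*ʳ x b y (suc k))) ⟨
    (a * y 0) * x (suc k) + (convTerm x (λ i → a * y (suc i)) (suc k) + convTerm x (λ i → b * y i) (suc k))
      ≈⟨ +-congˡ (convTerm-+ʳ x (λ i → a * y (suc i)) (λ i → b * y i) (suc k)) ⟨
    (a * y 0) * x (suc k) + convTerm x (linMulSer a b y) (suc k) ∎

  module Tails (n : ℕ) (T : ℕ → Ser)
               (T-recip : ∀ j → j < n → Recip (u j) (v j) (T (suc j)) (T j)) where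

    -- tailProduct m i = (-1)^i T_m T_(m+1) ⋯ T_(m+i); for m = 0 this is the part of
    -- F_i(X) T_0 in X^-1 k[[X^-1]], the error term of the i-th convergent.
    tailProduct : ℕ → ℕ → Ser
    tailProduct m zero    = T m
    tailProduct m (suc i) k = - convTerm (T m) (tailProduct (suc m) i) k

    tailProduct-order : ∀ i m k → k < i → tailProduct m i k ≈ 0#
    tailProduct-order (suc i) m zero    _         = -0#≈0#
    tailProduct-order (suc i) m (suc k) (s≤s k<i) =
      trans (-‿cong (sumTo-zero (suc k) (λ a _ →
              trans (*-congˡ (tailProduct-order i (suc m) (k ∸ a) (≤-<-trans (ℕₚ.m∸n≤m k a) k<i)))
                    (zeroʳ _))))
            -0#≈0#

    recip-linMulSer : ∀ p → p < n → ∀ k → linMulSer (u p) (v p) (T p) k ≈ tailProduct p 1 k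
    recip-linMulSer p p<n k = inverseˡ-unique _ _ (proj₂ (T-recip p p<n) k)

    tailProduct-recurrence : ∀ i m p → p ≡ suc i +ℕ m → p < n → ∀ k →
      linMulSer (u p) (v p) (tailProduct m (suc i)) k ≈ tailProduct m (suc (suc i)) k - tailProduct m i k
    tailProduct-recurrence zero m .(suc m) ≡.refl p<n k = begin
      linMulSer (u (suc m)) (v (suc m)) (tailProduct m 1) k
        ≈⟨ linMulSer-neg _ _ (convTerm (T m) (T (suc m))) k ⟩
      - linMulSer (u (suc m)) (v (suc m)) (convTerm (T m) (T (suc m))) k
        ≈⟨ -‿cong (linMulSer-convTerm _ _ (T m) (T (suc m)) k) ⟩
      - ((u (suc m) * T (suc m) 0) * T m k
          + convTerm (T m) (linMulSer (u (suc m)) (v (suc m)) (T (suc m))) k)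
        ≈⟨ -‿cong (+-cong (trans (*-congʳ (proj₁ (T-recip (suc m) p<n))) (*-identityˡ _))
                          (convTerm-congʳ (T m) (recip-linMulSer (suc m) p<n) k)) ⟩
      - (T m k + convTerm (T m) (tailProduct (suc m) 1) k)
        ≈⟨ trans (sym (-‿+-comm _ _)) (+-comm _ _) ⟩
      tailProduct m 2 k - T m k ∎
    tailProduct-recurrence (suc i) m p p≡ p<n k = begin
      linMulSer (u p) (v p) (tailProduct m (suc (suc i))) k
        ≈⟨ linMulSer-neg _ _ (convTerm (T m) (tailProduct (suc m) (suc i))) k ⟩
      - linMulSer (u p) (v p) (convTerm (T m) (tailProduct (suc m) (suc i))) k
        ≈⟨ -‿cong (linMulSer-convTerm _ _ (T m) _ k) ⟩
      - ((u p * tailProduct (suc m) (suc i) 0) * T m k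
          + convTerm (T m) (linMulSer (u p) (v p) (tailProduct (suc m) (suc i))) k)
        ≈⟨ -‿cong (+-cong leading (convTerm-congʳ (T m) (tailProduct-recurrence i (suc m) p p≡′ p<n) k)) ⟩
      - (0# + convTerm (T m) (λ k′ → tailProduct (suc m) (suc (suc i)) k′ - tailProduct (suc m) i k′) k)
        ≈⟨ -‿cong (trans (+-identityˡ _) (trans (convTerm-+ʳ (T m) (tailProduct (suc m) (suc (suc i))) (λ k′ → - tailProduct (suc m) i k′) k)
                                                   (+-congˡ (convTerm-negʳ (T m) (tailProduct (suc m) i) k)))) ⟩
      - (convTerm (T m) (tailProduct (suc m) (suc (suc i))) k - convTerm (T m) (tailProduct (suc m) i) k)
        ≈⟨ -‿+-comm _ _ ⟨
      tailProduct m (suc (suc (suc i))) k - tailProduct m (suc i) k ∎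
      where
        p≡′ : p ≡ suc i +ℕ suc m
        p≡′ = ≡.trans p≡ (≡.cong suc (≡.sym (ℕₚ.+-suc i m)))
        leading : (u p * tailProduct (suc m) (suc i) 0) * T m k ≈ 0#
        leading = trans (*-congʳ (trans (*-congˡ (tailProduct-order (suc i) (suc m) 0 (s≤s z≤n))) (zeroʳ _)))
                        (zeroˡ _)

    tailProduct-FibStep : ∀ l k → l < n → FibStep (λ i → tailProduct 0 i k) l (tailProduct 0 l (suc k))
    tailProduct-FibStep zero    k 0<n   = sym (recip-linMulSer 0 0<n k)
    tailProduct-FibStep (suc l) k l+1<n = x≈y-z⇒y≈x+z
      (tailProduct-recurrence l 0 (suc l) (≡.cong suc (≡.sym (ℕₚ.+-identityʳ l))) l+1<n k)

    tailProduct-Lrow : ∀ k l → l +ℕ k < n → tailProduct 0 l k ≈ u⁻¹ 0 * Lrow k l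
    tailProduct-Lrow zero zero 0<n =
      trans (inverse-unique (u 0) (hu 0) (proj₁ (T-recip 0 0<n))) (sym (*-identityʳ _))
    tailProduct-Lrow zero (suc l) _ = trans (tailProduct-order (suc l) 0 0 (s≤s z≤n)) (sym (zeroʳ _))
    tailProduct-Lrow (suc k) l l+k+1<n = begin
      tailProduct 0 l (suc k)
        ≈⟨ FibStep⇒·R _ l _ (tailProduct-FibStep l k (≤-<-trans (m≤m+n l (suc k)) l+k+1<n)) ⟨
      ((λ i → tailProduct 0 i k) ·R) l
        ≈⟨ sumTo-cong (suc (suc l)) (λ i i<l+2 → *-congʳ (tailProduct-Lrow k i (bound i i<l+2))) ⟩
      sumTo (suc (suc l)) (λ i → (u⁻¹ 0 * Lrow k i) * R i l)
        ≈⟨ trans (sumTo-cong (suc (suc l)) (λ i _ → *-assoc _ _ _)) (sumTo-*ˡ (suc (suc l)) _ _) ⟩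
      u⁻¹ 0 * (Lrow k ·R) l ∎
      where
        bound : ∀ i → i < suc (suc l) → i +ℕ k < n
        bound i i<l+2 = ≤-<-trans (ℕₚ.+-monoˡ-≤ k (≤-pred i<l+2)) (≡.subst (_< n) (ℕₚ.+-suc l k) l+k+1<n)

  -- Coefficients of 1/(aX + b + t) by course-of-values recursion: approx k is a
  -- series whose entries at indices ≤ k are already the final ones.
  module Reciprocal (a b : Carrier) (a≉0 : ¬ (a ≈ 0#)) (t : Ser) where
    approx : ℕ → Ser
    approx zero    _ = inv a a≉0
    approx (suc k) j = if ⌊ j ≤? k ⌋ then approx k j
                       else inv a a≉0 * - (b * approx k k + convTerm (approx k) t k)

    reciprocal : Ser
    reciprocal k = approx k k

    approx-stable : ∀ k j → j ≤ k → approx k j ≡ reciprocal j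
    approx-stable zero    zero z≤n = ≡.refl
    approx-stable (suc k) j j≤1+k with m≤n⇒m<n∨m≡n j≤1+k
    ... | inj₁ (s≤s j≤k) = ≡.trans (if-yes (j ≤? k) j≤k) (approx-stable k j j≤k)
    ... | inj₂ ≡.refl    = ≡.refl

    reciprocal-suc : ∀ k → reciprocal (suc k) ≡ inv a a≉0 * - (b * reciprocal k + convTerm (approx k) t k)
    reciprocal-suc k = if-no (suc k ≤? k) (n≮n k)

    convTerm-approx : ∀ k → convTerm (approx k) t k ≈ convTerm reciprocal t k
    convTerm-approx zero    = refl
    convTerm-approx (suc k) = sumTo-cong (suc k) (λ j j≤k →
      *-congʳ (reflexive (approx-stable (suc k) j (<⇒≤ j≤k))))

    reciprocal-step : ∀ k → (a * reciprocal (suc k) + b * reciprocal k) + convTerm reciprocal t k ≈ 0#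
    reciprocal-step k = begin
      (a * reciprocal (suc k) + b * reciprocal k) + convTerm reciprocal t k
        ≈⟨ +-congʳ (+-congʳ (*-congˡ (reflexive (reciprocal-suc k)))) ⟩
      (a * (inv a a≉0 * - r) + b * reciprocal k) + convTerm reciprocal t k
        ≈⟨ +-congʳ (+-congʳ (trans (sym (*-assoc _ _ _)) (trans (*-congʳ (inv-right a a≉0)) (*-identityˡ _)))) ⟩
      (- r + b * reciprocal k) + convTerm reciprocal t k
        ≈⟨ +-assoc _ _ _ ⟩
      - r + (b * reciprocal k + convTerm reciprocal t k)
        ≈⟨ +-congˡ (+-congˡ (convTerm-approx k)) ⟨
      - r + r
        ≈⟨ -‿inverseˡ r ⟩
      0# ∎
      where
        r : Carrier
        r = b * reciprocal k + convTerm (approx k) t k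

    reciprocal-Recip : Recip a b t reciprocal
    reciprocal-Recip = inv-right a a≉0 , reciprocal-step

  CFExp-exists : ∀ m n → Σ Ser (CFExp m n)
  CFExp-exists m zero    = (λ _ → 0#) , lift (λ _ → refl)
  CFExp-exists m (suc n) =
    let t , t-exp = CFExp-exists (suc m) n
        open Reciprocal (u m) (v m) (hu m) t
    in reciprocal , t , t-exp , reciprocal-Recip

  tails : ∀ m n s → CFExp m n s → ℕ → Ser
  tails m n       s _               zero    = s
  tails m zero    s _               (suc j) = λ _ → 0#
  tails m (suc n) s (t , t-exp , _) (suc j) = tails (suc m) n t t-exp j

  tails-Recip : ∀ m n s (s-exp : CFExp m n s) j → j < n →
    Recip (u (m +ℕ j)) (v (m +ℕ j)) (tails m n s s-exp (suc j)) (tails m n s s-exp j)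
  tails-Recip m (suc n) s (t , t-exp , r) zero    _         =
    ≡.subst (λ p → Recip (u p) (v p) t s) (≡.sym (ℕₚ.+-identityʳ m)) r
  tails-Recip m (suc n) s (t , t-exp , r) (suc j) (s≤s j<n) =
    ≡.subst (λ p → Recip (u p) (v p) (tails (suc m) n t t-exp (suc j)) (tails (suc m) n t t-exp j))
            (≡.sym (ℕₚ.+-suc m j)) (tails-Recip (suc m) n t t-exp j j<n)

  expansion-coefficient : ∀ cs → IsExpansion cs → ∀ k → cs k ≈ u⁻¹ 0 * Lrow k 0
  expansion-coefficient cs cs-exp k = begin
    cs k              ≈⟨ agrees n (m≤m+n n₀ (suc k)) s s-exp k ≤-refl ⟩
    s k               ≈⟨ Tails.tailProduct-Lrow n (tails 0 n s s-exp) (tails-Recip 0 n s s-exp) k 0 k<n ⟩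
    u⁻¹ 0 * Lrow k 0  ∎
    where
      n₀ = proj₁ (cs-exp k)
      agrees = proj₂ (cs-exp k)
      n = n₀ +ℕ suc k
      s = proj₁ (CFExp-exists 0 n)
      s-exp = proj₂ (CFExp-exists 0 n)
      k<n : k < n
      k<n = m≤n+m (suc k) n₀

theorem1 : ∀ {c ℓ} (K : Field c ℓ) (u v : ℕ → Field.Carrier K)
             (hu : ∀ n → ¬ (Field._≈_ K (u n) (Field.0# K)))
             (cs : ℕ → Field.Carrier K) →
             let open Phi K u v hu in
             IsExpansion cs →
             -- 1. L lower triangular, U upper triangular, nonzero diagonals
             ((∀ i j → i < j → L i j ≈ 0#) × (∀ i → ¬ (L i i ≈ 0#))
               × (∀ i j → j < i → U i j ≈ 0#) × (∀ i → ¬ (U i i ≈ 0#)))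
             -- 2. column n (0-based) of U = phi-Zeckendorf digits of X^n
             × (∀ n (z : ℕ → Carrier)
                  → (∀ j → Xpow n j ≈ sumTo (suc n) (λ i → z i * F i j))
                  → (∀ i → i ≤ n → U i n ≈ z i) × (∀ i → n < i → U i n ≈ 0#))
             -- 3. L U is a Hankel matrix
             × Σ (ℕ → Carrier) (λ h → ∀ i j → ProdEntry L U i j (h (i +ℕ j)))
             -- 4. (inverse of u_1) L U = M_phi
             × (∀ i j → Σ Carrier (λ x → ProdEntry L U i j x
                  × (inv (u 0) (hu 0) * x ≈ M cs i j)))
theorem1 K u v hu cs cs-exp =
    (Lrow-supported , Lrow-diagonal-nonzero , (λ i j → Ucol-supported j i) , Ucol-diagonal-nonzero)
  , (λ n z hz → Ucol-zeckendorf n z hz , Ucol-supported n)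
  , ((λ m → Ucol m 0) , LU-productEntry)
  , (λ i j → Ucol (i +ℕ j) 0 , LU-productEntry i j , hankel (i +ℕ j))
  where
    open Properties K u v hu
    open Phi K u v hu hiding (zero)
    hankel : ∀ m → u⁻¹ 0 * Ucol m 0 ≈ cs m
    hankel m = sym (trans (expansion-coefficient cs cs-exp m) (*-congˡ (Lrow≈Ucol-at-0 m)))
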